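{- For each integer $r\geq 7$ with $r\equiv 3 \pmod 4$, there exists an $r$-regular graph of order $\binom{r-1}{2}-1$ that is a $3$-kaleidoscope.
   Context: All graphs are finite, simple and undirected. Let $G$ be an $r$-regular graph and $k\geq 3$ an integer. An edge-coloring $c:E(G)\to\{1,2,\dots,k\}$ is called a $k$-kaleidoscopic coloring if (i) every vertex of $G$ is incident to at least one edge of each color $1,\dots,k$, and (ii) for every two distinct vertices $u,v$ of $G$, their multiset-colors differ, where the multiset-color of a vertex $v$ is the ordered tuple $c_m(v)=(a_1,\dots,a_k)$ with $a_i$ the number of edges of color $i$ incident with $v$. A regular graph $G$ is a $k$-kaleidoscope if it admits a $k$-kaleidoscopic coloring. -}

module Defs where

open import Data.Nat using (ℕ; zero; suc; _+_; _≥_)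
open import Data.Bool using (Bool; true; false; _∧_)
open import Data.Fin using (Fin; _≟_)
open import Data.List using (List; length; filter)
open import Data.Fin.Base using ()
open import Data.List.Base using ()
open import Data.Product using (Σ; _×_; _,_)
open import Relation.Nullary using (¬_; does)
open import Relation.Binary.PropositionalEquality using (_≡_; _≢_)
open import Data.Vec using (Vec; tabulate)
open import Data.Fin.Base using (toℕ)
open import Data.List.Base using (allFin)
open import Data.List.Base using ()

record Graph (n : ℕ) : Set where
  field
    adj     : Fin n → Fin n → Bool
    symm    : ∀ u v → adj u v ≡ adj v u
    irrefl  : ∀ v → adj v v ≡ false
open Graph public

count : ∀ {n} → (Fin n → Bool) → ℕ
count {n} p = length (filter (λ x → Data.Bool._≟_ (p x) true) (allFin n))

degree : ∀ {n} → Graph n → Fin n → ℕ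
degree G u = count (adj G u)

Regular : ∀ {n} → ℕ → Graph n → Set
Regular r G = ∀ u → degree G u ≡ r

-- An edge-coloring with colors Fin k: a symmetric assignment of a color to
-- every pair of vertices; only its values on edges are relevant.
record EdgeColoring {n} (G : Graph n) (k : ℕ) : Set where
  field
    col  : Fin n → Fin n → Fin k
    csym : ∀ u v → col u v ≡ col v u
open EdgeColoring public

colorDeg : ∀ {n k} {G : Graph n} → EdgeColoring G k → Fin n → Fin k → ℕ
colorDeg {G = G} c u i = count (λ v → adj G u v ∧ does (col c u v ≟ i))

multisetColor : ∀ {n k} {G : Graph n} → EdgeColoring G k → Fin n → Vec ℕ k
multisetColor c u = tabulate (colorDeg c u)

IsKaleidoscopic : ∀ {n k} {G : Graph n} → EdgeColoring G k → Set
IsKaleidoscopic {n} {k} c =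
  (∀ (u : Fin n) (i : Fin k) → colorDeg c u i ≥ 1) ×
  (∀ (u v : Fin n) → u ≢ v → multisetColor c u ≢ multisetColor c v)

-- G is a k-kaleidoscope (G regular is assumed separately)
IsKaleidoscope : ∀ {n} → ℕ → Graph n → Set
IsKaleidoscope {n} k G = Σ (EdgeColoring G k) IsKaleidoscopic

-- Let s = r - 3, so s ≡ 0 (mod 4), and take as vertices the lattice points (x , y , z) with
-- x + y + z = s other than the apex (0 , 0 , s): there are C(s + 2, 2) - 1 = C(r - 1, 2) - 1 of
-- them.  Each vertex a gets exactly x + 1 edges of colour 1, y + 1 of colour 2 and z + 1 of
-- colour 3, so it has degree s + 3 = r and its multiset-colour (x + 1 , y + 1 , z + 1)
-- determines it.  The colour-1 edges join a and b when x_a + x_b = s + 1 (a "line", giving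
-- x_a neighbours), together with a perfect matching: the reflection y ↔ z, repaired on the
-- diagonal y = z; colours 2 and 3 are analogous.  In the row z = 1 the colour-3 line would
-- only lead to the apex, so it is replaced by a second matching.  Lines of different colours
-- never share an edge since their coordinate sums would exceed 2s; the matchings avoid the
-- lines and each other by the parity patterns (XParity, ZParity, …) of their edges.

module Submission where

open import Defs
open import Data.Nat using (ℕ; zero; suc; _+_; _*_; _∸_; _≤_; _≥_; _%_; _/_; z≤n; s≤s)
open import Data.Nat.Properties
open import Data.Nat.DivMod using (m≡m%n+[m/n]*n)
open import Data.Nat.Combinatorics using (_C_; nC1≡n; nCk+nC[k+1]≡[n+1]C[k+1])
open import Data.Bool using (Bool; true; false; not; _∧_; _∨_; if_then_else_)
open import Data.Bool.Properties using (not-injective)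
import Data.Bool as Bool
open import Data.Fin using (Fin) renaming (zero to fzero; suc to fsuc)
import Data.Fin as Fin
open import Data.Fin.Properties using (any?)
open import Data.List using (List; []; _∷_; _++_; length; filter; map; allFin; lookup)
open import Data.List.Properties using (map-tabulate; tabulate-lookup; length-map; length-++)
open import Data.List.Membership.Propositional using (_∈_; _∉_)
open import Data.List.Membership.Propositional.Properties using (∈-lookup; ∈-map⁺; ∈-map⁻; ∈-++⁺ˡ; ∈-++⁺ʳ; ∈-++⁻)
open import Data.List.Relation.Unary.All using ([]; _∷_)
import Data.List.Relation.Unary.All as All
open import Data.List.Relation.Unary.Any using (here; there)
open import Data.List.Relation.Unary.AllPairs using ([]; _∷_)
open import Data.List.Relation.Unary.Unique.Propositional using (Unique)
open import Data.List.Relation.Unary.Unique.Propositional.Properties using (Unique[x∷xs]⇒x∉xs; map⁺; ++⁺)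
open import Data.Product using (Σ; _×_; _,_; proj₁; proj₂; ∃; map₁)
open import Data.Product.Properties using (≡-dec)
open import Data.Sum using (_⊎_; inj₁; inj₂)
open import Data.Empty using (⊥; ⊥-elim)
open import Data.Vec using (sum; tabulate)
import Data.Vec as Vec
open import Data.Vec.Properties using (tabulate-cong; lookup∘tabulate)
open import Function using (_∘_; id; mk⇔)
open import Relation.Binary.Definitions using (DecidableEquality)
open import Relation.Binary.PropositionalEquality
open import Data.Nat.Tactic.RingSolver using (solve-∀)
open import Relation.Nullary using (¬_; Dec; yes; no; does; contradiction)
open import Relation.Nullary.Decidable using (dec-true; dec-false; does-⇔)

private
  variable
    A B : Set

countList : (A → Bool) → List A → ℕ
countList p xs = length (filter (λ x → p x Bool.≟ true) xs)

countList-∷ : ∀ (p : A → Bool) x xs →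
  countList p (x ∷ xs) ≡ (if p x then suc (countList p xs) else countList p xs)
countList-∷ p x xs with p x
... | true  = refl
... | false = refl

countList-cong : ∀ {p q : A → Bool} → (∀ x → p x ≡ q x) → ∀ xs → countList p xs ≡ countList q xs
countList-cong p≗q [] = refl
countList-cong {p = p} {q} p≗q (x ∷ xs)
  rewrite countList-∷ p x xs | countList-∷ q x xs | p≗q x | countList-cong p≗q xs = refl

countList-map : ∀ (p : B → Bool) (f : A → B) xs →
  countList p (map f xs) ≡ countList (p ∘ f) xs
countList-map p f [] = refl
countList-map p f (x ∷ xs)
  rewrite countList-∷ p (f x) (map f xs) | countList-∷ (p ∘ f) x xs | countList-map p f xs = refl

countList-∨ : ∀ (p q : A → Bool) → (∀ x → p x ∧ q x ≡ false) → ∀ xs →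
  countList (λ x → p x ∨ q x) xs ≡ countList p xs + countList q xs
countList-∨ p q disjoint [] = refl
countList-∨ p q disjoint (x ∷ xs)
  rewrite countList-∷ (λ y → p y ∨ q y) x xs | countList-∷ p x xs | countList-∷ q x xs
        | countList-∨ p q disjoint xs
  with p x | q x | disjoint x
... | true  | true  | ()
... | true  | false | _ = refl
... | false | true  | _ = sym (+-suc _ _)
... | false | false | _ = refl

module _ (_≟_ : DecidableEquality A) where
  open import Data.List.Membership.DecPropositional _≟_ using (_∈?_)

  countList-≡ : ∀ {y xs} → Unique xs → y ∈ xs → countList (λ x → does (x ≟ y)) xs ≡ 1
  countList-≡ {y} {x ∷ xs} x∷xs-unique (here refl)
    rewrite countList-∷ (λ x → does (x ≟ y)) y xs | dec-true (y ≟ y) refl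
    = cong suc (countList-none xs (Unique[x∷xs]⇒x∉xs x∷xs-unique))
    where
      countList-none : ∀ zs → y ∉ zs → countList (λ x → does (x ≟ y)) zs ≡ 0
      countList-none [] _ = refl
      countList-none (z ∷ zs) y∉
        rewrite countList-∷ (λ x → does (x ≟ y)) z zs
              | dec-false (z ≟ y) (λ { refl → y∉ (here refl) }) = countList-none zs (y∉ ∘ there)
  countList-≡ {y} {x ∷ xs} x∷xs-unique@(_ ∷ xs-unique) (there y∈xs)
    rewrite countList-∷ (λ x → does (x ≟ y)) x xs
          | dec-false (x ≟ y) (λ { refl → Unique[x∷xs]⇒x∉xs x∷xs-unique y∈xs })
    = countList-≡ xs-unique y∈xs

  countList-∈ : ∀ xs ys → Unique xs → Unique ys → (∀ {y} → y ∈ ys → y ∈ xs) →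
    countList (λ x → does (x ∈? ys)) xs ≡ length ys
  countList-∈ xs [] _ _ _ = countList-none xs
    where
      countList-none : ∀ zs → countList (λ x → does (x ∈? [])) zs ≡ 0
      countList-none [] = refl
      countList-none (z ∷ zs) = countList-none zs
  countList-∈ xs (y ∷ ys) xs-unique y∷ys-unique@(_ ∷ ys-unique) ys⊆xs =
    begin
      countList (λ x → does (x ∈? y ∷ ys)) xs
    ≡⟨ countList-∨ (λ x → does (x ≟ y)) (λ x → does (x ∈? ys)) disjoint xs ⟩
      countList (λ x → does (x ≟ y)) xs + countList (λ x → does (x ∈? ys)) xs
    ≡⟨ cong₂ _+_ (countList-≡ xs-unique (ys⊆xs (here refl)))
                 (countList-∈ xs ys xs-unique ys-unique (ys⊆xs ∘ there)) ⟩
      suc (length ys)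
    ∎
    where
      open ≡-Reasoning
      disjoint : ∀ x → does (x ≟ y) ∧ does (x ∈? ys) ≡ false
      disjoint x with x ≟ y
      ... | yes refl = dec-false (y ∈? ys) (Unique[x∷xs]⇒x∉xs y∷ys-unique)
      ... | no _ = refl

sum-tabulate-zero : ∀ k → sum (tabulate {n = k} (λ _ → 0)) ≡ 0
sum-tabulate-zero zero = refl
sum-tabulate-zero (suc k) = sum-tabulate-zero k

sum-tabulate-bump : ∀ {k} (j : Fin k) (g : Fin k → ℕ) →
  sum (tabulate λ i → if does (j Fin.≟ i) then suc (g i) else g i) ≡ suc (sum (tabulate g))
sum-tabulate-bump fzero g = refl
sum-tabulate-bump (fsuc j) g = trans (cong (g fzero +_) (sum-tabulate-bump j (g ∘ fsuc))) (+-suc _ _)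

sum-tabulate-step : ∀ {k} b (j : Fin k) (g : Fin k → ℕ) →
  sum (tabulate λ i → if b ∧ does (j Fin.≟ i) then suc (g i) else g i) ≡
  (if b then suc (sum (tabulate g)) else sum (tabulate g))
sum-tabulate-step false j g = refl
sum-tabulate-step true  j g = sum-tabulate-bump j g

countList-partition : ∀ {k} (f : A → Fin k) (p : A → Bool) xs →
  countList p xs ≡ sum (tabulate λ i → countList (λ x → p x ∧ does (f x Fin.≟ i)) xs)
countList-partition {k = k} f p [] = sym (sum-tabulate-zero k)
countList-partition f p (x ∷ xs) =
  begin
    countList p (x ∷ xs)
  ≡⟨ countList-∷ p x xs ⟩
    (if p x then suc (countList p xs) else countList p xs)
  ≡⟨ cong (λ n → if p x then suc n else n) (countList-partition f p xs) ⟩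
    (if p x then suc (sum (tabulate count-xs)) else sum (tabulate count-xs))
  ≡⟨ sum-tabulate-step (p x) (f x) count-xs ⟨
    sum (tabulate λ i → if p x ∧ does (f x Fin.≟ i) then suc (count-xs i) else count-xs i)
  ≡⟨ cong sum (tabulate-cong λ i → countList-∷ (λ y → p y ∧ does (f y Fin.≟ i)) x xs) ⟨
    sum (tabulate λ i → countList (λ y → p y ∧ does (f y Fin.≟ i)) (x ∷ xs))
  ∎
  where
    open ≡-Reasoning
    count-xs : Fin _ → ℕ
    count-xs i = countList (λ y → p y ∧ does (f y Fin.≟ i)) xs

degree≡sum-multisetColor : ∀ {n k} {G : Graph n} (c : EdgeColoring G k) u →
  degree G u ≡ sum (multisetColor c u)
degree≡sum-multisetColor {n} {G = G} c u = countList-partition (col c u) (adj G u) (allFin n)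

map-lookup-allFin : ∀ (xs : List A) → map (lookup xs) (allFin (length xs)) ≡ xs
map-lookup-allFin xs = trans (map-tabulate id (lookup xs)) (tabulate-lookup xs)

lookup-injective : ∀ {xs : List A} → Unique xs → ∀ i j → lookup xs i ≡ lookup xs j → i ≡ j
lookup-injective {xs = _ ∷ _} _ fzero fzero _ = refl
lookup-injective {xs = _ ∷ _} (x∉ ∷ _) fzero (fsuc j) eq = contradiction eq (All.lookup x∉ (∈-lookup j))
lookup-injective {xs = _ ∷ _} (x∉ ∷ _) (fsuc i) fzero eq = contradiction (sym eq) (All.lookup x∉ (∈-lookup i))
lookup-injective {xs = _ ∷ _} (_ ∷ xs-unique) (fsuc i) (fsuc j) eq = cong fsuc (lookup-injective xs-unique i j eq)

record ColouredNeighbourhoods (V : List A) (k : ℕ) : Set where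
  field
    nbrs          : Fin k → A → List A
    nbrs⊆V        : ∀ i {a b} → a ∈ V → b ∈ nbrs i a → b ∈ V
    nbrs-unique   : ∀ i {a} → a ∈ V → Unique (nbrs i a)
    nbrs-sym      : ∀ i {a b} → a ∈ V → b ∈ nbrs i a → a ∈ nbrs i b
    nbrs-irrefl   : ∀ i {a} → a ∈ V → a ∉ nbrs i a
    nbrs-disjoint : ∀ {i j a b} → a ∈ V → b ∈ nbrs i a → b ∈ nbrs j a → i ≡ j

module _ {k : ℕ} where

  -- Pairs that are not edges get the junk colour fzero.
  colourOf : ∀ {P : Fin (suc k) → Set} → Dec (∃ P) → Fin (suc k)
  colourOf (yes (i , _)) = i
  colourOf (no _)        = fzero

  colourOf-indicator : ∀ {P : Fin (suc k) → Set} (P? : ∀ i → Dec (P i)) →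
    (∀ {i j} → P i → P j → i ≡ j) → (d : Dec (∃ P)) →
    ∀ i → does d ∧ does (colourOf d Fin.≟ i) ≡ does (P? i)
  colourOf-indicator P? P-unique (yes (j , Pj)) i =
    does-⇔ (mk⇔ (λ { refl → Pj }) (P-unique Pj)) (j Fin.≟ i) (P? i)
  colourOf-indicator P? P-unique (no ¬∃P) i = sym (dec-false (P? i) (λ Pi → ¬∃P (i , Pi)))

  colourOf-cong : ∀ {P Q : Fin (suc k) → Set} → (∀ {i} → P i → Q i) → (∀ {i} → Q i → P i) →
    (∀ {i j} → P i → P j → i ≡ j) → (d : Dec (∃ P)) (e : Dec (∃ Q)) → colourOf d ≡ colourOf e
  colourOf-cong P⇒Q Q⇒P P-unique (yes (i , Pi)) (yes (j , Qj)) = P-unique Pi (Q⇒P Qj)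
  colourOf-cong P⇒Q Q⇒P P-unique (yes (i , Pi)) (no ¬∃Q) = contradiction (i , P⇒Q Pi) ¬∃Q
  colourOf-cong P⇒Q Q⇒P P-unique (no ¬∃P) (yes (j , Qj)) = contradiction (j , Q⇒P Qj) ¬∃P
  colourOf-cong P⇒Q Q⇒P P-unique (no _) (no _) = refl

module NeighbourhoodGraph (_≟_ : DecidableEquality A) {V : List A} (V-unique : Unique V)
                          {k : ℕ} (N : ColouredNeighbourhoods V (suc k)) where
  open ColouredNeighbourhoods N
  open import Data.List.Membership.DecPropositional _≟_ using (_∈?_)

  vertex : Fin (length V) → A
  vertex = lookup V

  edge? : ∀ a b → Dec (∃ λ i → b ∈ nbrs i a)
  edge? a b = any? (λ i → b ∈? nbrs i a)

  edge-sym : ∀ u v → (∃ λ i → vertex v ∈ nbrs i (vertex u)) → ∃ λ i → vertex u ∈ nbrs i (vertex v)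
  edge-sym u v (i , v∈) = i , nbrs-sym i (∈-lookup u) v∈

  graph : Graph (length V)
  graph = record
    { adj    = λ u v → does (edge? (vertex u) (vertex v))
    ; symm   = λ u v → does-⇔ (mk⇔ (edge-sym u v) (edge-sym v u))
                              (edge? (vertex u) (vertex v)) (edge? (vertex v) (vertex u))
    ; irrefl = λ u → dec-false (edge? (vertex u) (vertex u)) λ (i , u∈) → nbrs-irrefl i (∈-lookup u) u∈
    }

  colouring : EdgeColoring graph (suc k)
  colouring = record
    { col  = λ u v → colourOf (edge? (vertex u) (vertex v))
    ; csym = λ u v → colourOf-cong (λ {i} → nbrs-sym i (∈-lookup u)) (λ {i} → nbrs-sym i (∈-lookup v))
                                   (nbrs-disjoint (∈-lookup u))
                                   (edge? (vertex u) (vertex v)) (edge? (vertex v) (vertex u))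
    }

  colorDeg-colouring : ∀ u i → colorDeg colouring u i ≡ length (nbrs i (vertex u))
  colorDeg-colouring u i =
    begin
      countList (is-i-edge ∘ vertex) (allFin (length V))
    ≡⟨ countList-map is-i-edge vertex (allFin (length V)) ⟨
      countList is-i-edge (map vertex (allFin (length V)))
    ≡⟨ cong (countList is-i-edge) (map-lookup-allFin V) ⟩
      countList is-i-edge V
    ≡⟨ countList-cong (λ b → colourOf-indicator (λ j → b ∈? nbrs j a) (nbrs-disjoint a∈V) (edge? a b) i) V ⟩
      countList (λ b → does (b ∈? nbrs i a)) V
    ≡⟨ countList-∈ _≟_ V (nbrs i a) V-unique (nbrs-unique i a∈V) (nbrs⊆V i a∈V) ⟩
      length (nbrs i a)
    ∎
    where
      open ≡-Reasoning
      a : A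
      a = vertex u
      a∈V : a ∈ V
      a∈V = ∈-lookup u
      is-i-edge : A → Bool
      is-i-edge b = does (edge? a b) ∧ does (colourOf (edge? a b) Fin.≟ i)

  degree-graph : ∀ u → degree graph u ≡ sum (tabulate λ i → length (nbrs i (vertex u)))
  degree-graph u = trans (degree≡sum-multisetColor colouring u) (cong sum (tabulate-cong (colorDeg-colouring u)))

  colouring-isKaleidoscopic :
    (∀ i {a} → a ∈ V → 1 ≤ length (nbrs i a)) →
    (∀ {a b} → a ∈ V → b ∈ V → (∀ i → length (nbrs i a) ≡ length (nbrs i b)) → a ≡ b) →
    IsKaleidoscopic colouring
  colouring-isKaleidoscopic nonempty determined =
    (λ u i → subst (1 ≤_) (sym (colorDeg-colouring u i)) (nonempty i (∈-lookup u))) ,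
    (λ u v u≢v same → u≢v (lookup-injective V-unique u v
       (determined (∈-lookup u) (∈-lookup v) (λ i → same-length u v i same))))
    where
      same-length : ∀ u v i → multisetColor colouring u ≡ multisetColor colouring v →
        length (nbrs i (vertex u)) ≡ length (nbrs i (vertex v))
      same-length u v i same =
        begin
          length (nbrs i (vertex u))  ≡⟨ colorDeg-colouring u i ⟨
          colorDeg colouring u i      ≡⟨ lookup∘tabulate (colorDeg colouring u) i ⟨
          Vec.lookup (multisetColor colouring u) i ≡⟨ cong (λ w → Vec.lookup w i) same ⟩
          Vec.lookup (multisetColor colouring v) i ≡⟨ lookup∘tabulate (colorDeg colouring v) i ⟩
          colorDeg colouring v i      ≡⟨ colorDeg-colouring v i ⟩
          length (nbrs i (vertex v))  ∎
        where open ≡-Reasoning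

even : ℕ → Bool
even zero          = true
even (suc zero)    = false
even (suc (suc n)) = even n

even-suc : ∀ n → even (suc n) ≡ not (even n)
even-suc zero          = refl
even-suc (suc zero)    = refl
even-suc (suc (suc n)) = even-suc n

even-+ : ∀ m n → even (m + n) ≡ (if even m then even n else not (even n))
even-+ zero          n = refl
even-+ (suc zero)    n = even-suc n
even-+ (suc (suc m)) n = even-+ m n

even-+-same : ∀ m n → even m ≡ even n → even (m + n) ≡ true
even-+-same m n m≡n rewrite even-+ m n | m≡n with even n
... | true  = refl
... | false = refl

even-double : ∀ n → even (n + n) ≡ true
even-double n = even-+-same n n refl

even-1+double : ∀ n → even (suc (n + n)) ≡ false
even-1+double n = trans (even-suc (n + n)) (cong not (even-double n))

even-+2 : ∀ n → even (n + 2) ≡ even n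
even-+2 n rewrite even-+ n 2 with even n
... | true  = refl
... | false = refl

even-+-evenˡ : ∀ m n → even m ≡ true → even (m + n) ≡ even n
even-+-evenˡ m n m-even rewrite even-+ m n | m-even = refl

double-injective : ∀ {m n} → m + m ≡ n + n → m ≡ n
double-injective {zero}  {zero}  _  = refl
double-injective {suc m} {suc n} eq rewrite +-suc m m | +-suc n n =
  cong suc (double-injective (suc-injective (suc-injective eq)))

lowMod4 : ℕ → Bool
lowMod4 zero                      = true
lowMod4 (suc zero)                = true
lowMod4 (suc (suc zero))          = false
lowMod4 (suc (suc (suc zero)))    = false
lowMod4 (suc (suc (suc (suc n)))) = lowMod4 n

lowMod4-2+ : ∀ n → lowMod4 (suc (suc n)) ≡ not (lowMod4 n)
lowMod4-2+ zero                      = refl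
lowMod4-2+ (suc zero)                = refl
lowMod4-2+ (suc (suc zero))          = refl
lowMod4-2+ (suc (suc (suc zero)))    = refl
lowMod4-2+ (suc (suc (suc (suc n)))) = lowMod4-2+ n

lowMod4-+2 : ∀ x → lowMod4 (x + 2) ≡ not (lowMod4 x)
lowMod4-+2 x = trans (cong lowMod4 (+-comm x 2)) (lowMod4-2+ x)

lowMod4-2+4* : ∀ q → lowMod4 (2 + 4 * q) ≡ false
lowMod4-2+4* zero    = refl
lowMod4-2+4* (suc q) = trans (cong (λ m → lowMod4 (2 + m)) (*-suc 4 q)) (lowMod4-2+4* q)

lowMod4-3+4* : ∀ q → lowMod4 (3 + 4 * q) ≡ false
lowMod4-3+4* zero    = refl
lowMod4-3+4* (suc q) = trans (cong (λ m → lowMod4 (3 + m)) (*-suc 4 q)) (lowMod4-3+4* q)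

Point : Set
Point = ℕ × ℕ × ℕ

_≟ᴾ_ : DecidableEquality Point
_≟ᴾ_ = ≡-dec _≟_ (≡-dec _≟_ _≟_)

xOf yOf zOf : Point → ℕ
xOf (x , _ , _) = x
yOf (_ , y , _) = y
zOf (_ , _ , z) = z

point-≡ : ∀ {x y z x′ y′ z′ : ℕ} → x ≡ x′ → y ≡ y′ → z ≡ z′ → (x , y , z) ≡ (x′ , y′ , z′)
point-≡ refl refl refl = refl

total : Point → ℕ
total (x , y , z) = x + y + z

swapXY : Point → Point
swapXY (x , y , z) = (y , x , z)

rotate : Point → Point
rotate (x , y , z) = (z , x , y)

unrotate : Point → Point
unrotate (x , y , z) = (y , z , x)

swapXY-involutive : ∀ a → swapXY (swapXY a) ≡ a
swapXY-involutive _ = refl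

pairs : ℕ → List (ℕ × ℕ)
pairs zero    = (0 , 0) ∷ []
pairs (suc n) = (0 , suc n) ∷ map (map₁ suc) (pairs n)

∈-pairs⁻ : ∀ n {p q} → (p , q) ∈ pairs n → p + q ≡ n
∈-pairs⁻ zero    (here refl) = refl
∈-pairs⁻ (suc n) (here refl) = refl
∈-pairs⁻ (suc n) (there pq∈) with ∈-map⁻ (map₁ suc) pq∈
... | _ , pq∈′ , refl = cong suc (∈-pairs⁻ n pq∈′)

∈-pairs⁺ : ∀ {n} p q → p + q ≡ n → (p , q) ∈ pairs n
∈-pairs⁺ {zero}  zero    zero    _  = here refl
∈-pairs⁺ {suc n} zero    q       eq = here (cong (0 ,_) eq)
∈-pairs⁺ {suc n} (suc p) q       eq = there (∈-map⁺ (map₁ suc) (∈-pairs⁺ p q (suc-injective eq)))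

length-pairs : ∀ n → length (pairs n) ≡ suc n
length-pairs zero    = refl
length-pairs (suc n) = cong suc (trans (length-map (map₁ suc) (pairs n)) (length-pairs n))

map₁-suc-injective : ∀ {a b : ℕ × ℕ} → map₁ suc a ≡ map₁ suc b → a ≡ b
map₁-suc-injective {_ , _} {_ , _} refl = refl

pairs-unique : ∀ n → Unique (pairs n)
pairs-unique zero    = [] ∷ []
pairs-unique (suc n) = All.tabulate head-fresh ∷ map⁺ map₁-suc-injective (pairs-unique n)
  where
    head-fresh : ∀ {b} → b ∈ map (map₁ suc) (pairs n) → (0 , suc n) ≢ b
    head-fresh b∈ with ∈-map⁻ (map₁ suc) b∈
    head-fresh b∈ | _ , _ , refl = λ ()

incX : Point → Point
incX (x , y , z) = (suc x , y , z)

incX-injective : ∀ {a b} → incX a ≡ incX b → a ≡ b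
incX-injective {_ , _ , _} {_ , _ , _} refl = refl

onYZ : ℕ × ℕ → Point
onYZ (p , q) = (0 , suc p , q)

onYZ-injective : ∀ {a b} → onYZ a ≡ onYZ b → a ≡ b
onYZ-injective {_ , _} {_ , _} refl = refl

triples : ℕ → List Point
apexFreeTriples : ℕ → List Point

triples zero    = (0 , 0 , 0) ∷ []
triples (suc n) = (0 , 0 , suc n) ∷ apexFreeTriples n

apexFreeTriples n = map incX (triples n) ++ map onYZ (pairs n)

∈-triples⁻ : ∀ n {b} → b ∈ triples n → total b ≡ n
∈-apexFreeTriples⁻ : ∀ n {b} → b ∈ apexFreeTriples n → total b ≡ suc n × b ≢ (0 , 0 , suc n)

∈-triples⁻ zero    (here refl) = refl
∈-triples⁻ (suc n) (here refl) = refl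
∈-triples⁻ (suc n) (there b∈)  = proj₁ (∈-apexFreeTriples⁻ n b∈)

∈-apexFreeTriples⁻ n b∈ with ∈-++⁻ (map incX (triples n)) b∈
... | inj₁ b∈incX with ∈-map⁻ incX b∈incX
...   | _ , a∈ , refl = cong suc (∈-triples⁻ n a∈) , λ ()
∈-apexFreeTriples⁻ n b∈ | inj₂ b∈onYZ with ∈-map⁻ onYZ b∈onYZ
...   | _ , pq∈ , refl = cong suc (∈-pairs⁻ n pq∈) , λ ()

∈-triples⁺ : ∀ {n} b → total b ≡ n → b ∈ triples n
∈-apexFreeTriples⁺ : ∀ {n} b → total b ≡ suc n → b ≢ (0 , 0 , suc n) → b ∈ apexFreeTriples n

∈-triples⁺ {zero}  (zero , zero , zero) _ = here refl
∈-triples⁺ {suc n} b b-total with b ≟ᴾ (0 , 0 , suc n)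
... | yes b≡apex = here b≡apex
... | no  b≢apex = there (∈-apexFreeTriples⁺ b b-total b≢apex)

∈-apexFreeTriples⁺ (suc x , y , z) b-total _ =
  ∈-++⁺ˡ (∈-map⁺ incX (∈-triples⁺ (x , y , z) (suc-injective b-total)))
∈-apexFreeTriples⁺ {n} (zero , suc y , z) b-total _ =
  ∈-++⁺ʳ (map incX (triples n)) (∈-map⁺ onYZ (∈-pairs⁺ y z (suc-injective b-total)))
∈-apexFreeTriples⁺ (zero , zero , z) b-total b≢apex = contradiction (cong (λ w → (0 , 0 , w)) b-total) b≢apex

triples-unique : ∀ n → Unique (triples n)
apexFreeTriples-unique : ∀ n → Unique (apexFreeTriples n)

triples-unique zero    = [] ∷ []
triples-unique (suc n) =
  All.tabulate (λ b∈ apex≡b → proj₂ (∈-apexFreeTriples⁻ n b∈) (sym apex≡b)) ∷ apexFreeTriples-unique n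

apexFreeTriples-unique n =
  ++⁺ (map⁺ incX-injective (triples-unique n)) (map⁺ onYZ-injective (pairs-unique n)) x-positive-vs-zero
  where
    x-positive-vs-zero : ∀ {b} → ¬ (b ∈ map incX (triples n) × b ∈ map onYZ (pairs n))
    x-positive-vs-zero (b∈incX , b∈onYZ) with ∈-map⁻ incX b∈incX | ∈-map⁻ onYZ b∈onYZ
    ... | _ , _ , refl | _ , _ , ()

length-triples : ∀ n → length (triples n) ≡ suc (suc n) C 2
length-apexFreeTriples-split : ∀ n → length (apexFreeTriples n) ≡ suc (suc n) C 2 + suc n

length-triples zero    = refl
length-triples (suc n) =
  begin
    suc (length (apexFreeTriples n))
  ≡⟨ cong suc (length-apexFreeTriples-split n) ⟩
    suc (suc (suc n) C 2 + suc n)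
  ≡⟨ cong suc (+-comm (suc (suc n) C 2) (suc n)) ⟩
    suc (suc n) + suc (suc n) C 2
  ≡⟨ cong (_+ suc (suc n) C 2) (nC1≡n (suc (suc n))) ⟨
    suc (suc n) C 1 + suc (suc n) C 2
  ≡⟨ nCk+nC[k+1]≡[n+1]C[k+1] (suc (suc n)) 1 ⟩
    suc (suc (suc n)) C 2
  ∎
  where open ≡-Reasoning

length-apexFreeTriples : ∀ n → length (apexFreeTriples n) ≡ suc (suc (suc n)) C 2 ∸ 1
length-apexFreeTriples n = cong (_∸ 1) (length-triples (suc n))

length-apexFreeTriples-split n =
  trans (length-++ (map incX (triples n)))
        (cong₂ _+_ (trans (length-map incX (triples n)) (length-triples n))
                   (trans (length-map onYZ (pairs n)) (length-pairs n)))

module Triangle (s : ℕ) where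

  OnTriangle : Point → Set
  OnTriangle a = total a ≡ s

  apex : Point
  apex = (0 , 0 , s)

  IsVertex : Point → Set
  IsVertex a = OnTriangle a × a ≢ apex

  swapXY-onTriangle : ∀ {a} → OnTriangle a → OnTriangle (swapXY a)
  swapXY-onTriangle {x , y , z} = trans (cong (_+ z) (+-comm y x))

  rotate-onTriangle : ∀ {a} → OnTriangle a → OnTriangle (rotate a)
  rotate-onTriangle {x , y , z} = trans (+-rotate x y z)
    where
      +-rotate : ∀ x y z → z + x + y ≡ x + y + z
      +-rotate = solve-∀

  unrotate-onTriangle : ∀ {a} → OnTriangle a → OnTriangle (unrotate a)
  unrotate-onTriangle {x , y , z} = trans (+-unrotate x y z)
    where
      +-unrotate : ∀ x y z → y + z + x ≡ x + y + z
      +-unrotate = solve-∀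

  x+y≤s : ∀ {a} → OnTriangle a → xOf a + yOf a ≤ s
  x+y≤s {x , y , z} on = subst (x + y ≤_) on (m≤m+n (x + y) z)

  x+z≤s : ∀ {a} → OnTriangle a → xOf a + zOf a ≤ s
  x+z≤s {x , y , z} on = subst (x + z ≤_) (trans (+-swap x y z) on) (m≤m+n (x + z) y)
    where
      +-swap : ∀ x y z → x + z + y ≡ x + y + z
      +-swap = solve-∀

  y+z≤s : ∀ {a} → OnTriangle a → yOf a + zOf a ≤ s
  y+z≤s {x , y , z} on = subst (y + z ≤_) (trans (sym (+-assoc x y z)) on) (m≤n+m (y + z) x)

  x≤s : ∀ {a} → OnTriangle a → xOf a ≤ s
  x≤s {a} on = ≤-trans (m≤m+n (xOf a) (yOf a)) (x+y≤s {a} on)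

  ≤s⇒≢1+s : ∀ {m} → m ≤ s → m ≢ suc s
  ≤s⇒≢1+s m≤s refl = 1+n≰n m≤s

  onTriangle-xy : ∀ {a b} → OnTriangle a → OnTriangle b → xOf a ≡ xOf b → yOf a ≡ yOf b → a ≡ b
  onTriangle-xy {x , y , z} {.x , .y , z′} on on′ refl refl =
    point-≡ refl refl (+-cancelˡ-≡ (x + y) z z′ (trans on (sym on′)))

  onTriangle-xz : ∀ {a b} → OnTriangle a → OnTriangle b → xOf a ≡ xOf b → zOf a ≡ zOf b → a ≡ b
  onTriangle-xz {a} {b} on on′ x≡ z≡ =
    cong unrotate (onTriangle-xy (rotate-onTriangle {a} on) (rotate-onTriangle {b} on′) z≡ x≡)

  onTriangle-yz : ∀ {a b} → OnTriangle a → OnTriangle b → yOf a ≡ yOf b → zOf a ≡ zOf b → a ≡ b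
  onTriangle-yz {a} {b} on on′ y≡ z≡ =
    cong rotate (onTriangle-xy (unrotate-onTriangle {a} on) (unrotate-onTriangle {b} on′) y≡ z≡)

  OnLine : (Point → ℕ) → Point → Point → Set
  OnLine c a b = OnTriangle b × c a + c b ≡ suc s

  withX : ℕ → ℕ × ℕ → Point
  withX c (p , q) = (c , p , q)

  withX-injective : ∀ {c a b} → withX c a ≡ withX c b → a ≡ b
  withX-injective {a = _ , _} {_ , _} refl = refl

  lineX : Point → List Point
  lineX (zero  , y , z) = []
  lineX (suc x , y , z) = map (withX (suc (y + z))) (pairs x)

  lineX-sound : ∀ {a b} → OnTriangle a → b ∈ lineX a → OnLine xOf a b
  lineX-sound {suc x , y , z} on b∈ with ∈-map⁻ (withX (suc (y + z))) b∈
  ... | (p , q) , pq∈ , refl =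
    trans (+-assoc (suc (y + z)) p q) (trans (cong (suc (y + z) +_) (∈-pairs⁻ x pq∈)) (trans (regroup x y z) on)) ,
    trans (sym (regroup′ x y z)) (cong suc on)
    where
      regroup : ∀ x y z → suc (y + z) + x ≡ suc x + y + z
      regroup = solve-∀
      regroup′ : ∀ x y z → suc (suc x + y + z) ≡ suc x + suc (y + z)
      regroup′ = solve-∀

  lineX-complete : ∀ {a b} → OnTriangle a → OnLine xOf a b → b ∈ lineX a
  lineX-complete {zero , y , z} {b} _ (on-b , 0+bx≡1+s) = contradiction 0+bx≡1+s (≤s⇒≢1+s (x≤s {b} on-b))
  lineX-complete {suc x , y , z} {bx , p , q} on (on-b , line) =
    subst (_∈ lineX (suc x , y , z)) (cong (_, p , q) (sym bx≡)) (∈-map⁺ (withX (suc (y + z))) (∈-pairs⁺ p q p+q≡x))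
    where
      bx≡ : bx ≡ suc (y + z)
      bx≡ = +-cancelˡ-≡ (suc x) bx (suc (y + z)) (trans line (trans (cong suc (sym on)) (regroup x y z)))
        where
          regroup : ∀ x y z → suc (suc x + y + z) ≡ suc x + suc (y + z)
          regroup = solve-∀
      p+q≡x : p + q ≡ x
      p+q≡x = +-cancelˡ-≡ (suc (y + z)) (p + q) x
                (trans (sym (+-assoc (suc (y + z)) p q))
                  (trans (subst (λ w → w + p + q ≡ s) bx≡ on-b) (trans (sym on) (regroup x y z))))
        where
          regroup : ∀ x y z → suc x + y + z ≡ suc (y + z) + x
          regroup = solve-∀

  length-lineX : ∀ a → length (lineX a) ≡ xOf a
  length-lineX (zero  , y , z) = refl
  length-lineX (suc x , y , z) = trans (length-map (withX (suc (y + z))) (pairs x)) (length-pairs x)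

  lineX-unique : ∀ a → Unique (lineX a)
  lineX-unique (zero  , y , z) = []
  lineX-unique (suc x , y , z) = map⁺ withX-injective (pairs-unique x)

  record Frame : Set where
    field
      to from         : Point → Point
      to∘from         : ∀ b → to (from b) ≡ b
      from∘to         : ∀ b → from (to b) ≡ b
      to-onTriangle   : ∀ {b} → OnTriangle b → OnTriangle (to b)
      from-onTriangle : ∀ {b} → OnTriangle b → OnTriangle (from b)

  module _ (F : Frame) where
    open Frame F

    line : Point → List Point
    line a = map from (lineX (to a))

    line-sound : ∀ {a b} → OnTriangle a → b ∈ line a → OnLine (xOf ∘ to) a b
    line-sound {a} on b∈ with ∈-map⁻ from b∈
    ... | c , c∈ , refl with lineX-sound (to-onTriangle on) c∈
    ...   | on-c , on-line = from-onTriangle on-c , trans (cong (λ w → xOf (to a) + xOf w) (to∘from c)) on-line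

    line-complete : ∀ {a b} → OnTriangle a → OnLine (xOf ∘ to) a b → b ∈ line a
    line-complete {a} {b} on (on-b , on-line) =
      subst (_∈ line a) (from∘to b) (∈-map⁺ from (lineX-complete (to-onTriangle on) (to-onTriangle on-b , on-line)))

    length-line : ∀ a → length (line a) ≡ xOf (to a)
    length-line a = trans (length-map from (lineX (to a))) (length-lineX (to a))

    line-unique : ∀ a → Unique (line a)
    line-unique a = map⁺ from-injective (lineX-unique (to a))
      where
        from-injective : ∀ {b c} → from b ≡ from c → b ≡ c
        from-injective {b} {c} eq = trans (sym (to∘from b)) (trans (cong to eq) (to∘from c))

  frameX frameY frameZ : Frame
  frameX = record { to = id ; from = id ; to∘from = λ _ → refl ; from∘to = λ _ → refl
                  ; to-onTriangle = id ; from-onTriangle = id }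
  frameY = record { to = swapXY ; from = swapXY ; to∘from = swapXY-involutive ; from∘to = swapXY-involutive
                  ; to-onTriangle = λ {b} → swapXY-onTriangle {b} ; from-onTriangle = λ {b} → swapXY-onTriangle {b} }
  frameZ = record { to = rotate ; from = unrotate ; to∘from = λ _ → refl ; from∘to = λ _ → refl
                  ; to-onTriangle = λ {b} → rotate-onTriangle {b} ; from-onTriangle = λ {b} → unrotate-onTriangle {b} }

  lines-cross : ∀ (c d : Point → ℕ) {a b} → c a + d a ≤ s → c b + d b ≤ s →
    OnLine c a b → OnLine d a b → ⊥
  lines-cross c d {a} {b} a-bound b-bound (_ , c-line) (_ , d-line) =
    1+n≰n (≤-trans (n≤1+n _) (subst (_≤ s + s) sums (+-mono-≤ a-bound b-bound)))
    where
      sums : c a + d a + (c b + d b) ≡ suc (suc (s + s))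
      sums = trans (interchange (c a) (d a) (c b) (d b)) (trans (cong₂ _+_ c-line d-line) (cong suc (+-suc s s)))
        where
          interchange : ∀ p q p′ q′ → p + q + (p′ + q′) ≡ p + p′ + (q + q′)
          interchange = solve-∀

module Construction (k : ℕ) where

  h s : ℕ
  h = suc k + suc k
  s = h + h

  open Triangle s

  even-h : even h ≡ true
  even-h = even-double (suc k)

  even-s : even s ≡ true
  even-s = even-double h

  even⇒≢1+s : ∀ {m} → even m ≡ true → m ≢ suc s
  even⇒≢1+s m-even refl = contradiction (trans (sym m-even) (trans (even-suc s) (cong not even-s))) λ ()

  h≢0 : h ≢ 0
  h≢0 ()

  s≢0 : s ≢ 0
  s≢0 ()

  h+s≢1+s : h + s ≢ suc s
  h+s≢1+s eq = m+1+n≢0 k (suc-injective (+-cancelʳ-≡ s h 1 eq))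

  h≤s : h ≤ s
  h≤s = m≤m+n h h

  y+1+y≡1+s⇒y≡h : ∀ {y} → y + suc y ≡ suc s → y ≡ h
  y+1+y≡1+s⇒y≡h {y} eq = double-injective (suc-injective (trans (sym (+-suc y y)) eq))

  even-y+1+y : ∀ y → even (y + suc y) ≡ false
  even-y+1+y y = trans (cong even (+-suc y y)) (even-1+double y)

  record Partners (Parity : Point → Point → Set) (m : Point → Point) (a e : Point) : Set where
    field
      vertex    : IsVertex e
      distinct  : e ≢ a
      off-lineX : xOf a + xOf e ≢ suc s
      off-lineY : yOf a + yOf e ≢ suc s
      off-lineZ : zOf a + zOf e ≢ suc s
      parity    : Parity a e
      back      : m e ≡ a

  XParity : Point → Point → Set
  XParity a e = even (xOf a + xOf e) ≡ true × (even (yOf a + yOf e) ≡ true → xOf a ≡ xOf e)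

  cornerY midYZ : Point
  cornerY = (0 , s , 0)
  midYZ   = (0 , h , h)

  -- On the diagonal y = z the points are paired (x , 2j , 2j) ↔ (x - 2 , 2j + 1 , 2j + 1);
  -- this uses h even, and the leftover point midYZ is paired with the corner (0 , s , 0),
  -- which has lost its reflection (0 , 0 , s) = apex.
  xDiagonal : ℕ → ℕ → Point
  xDiagonal x y with y ≟ h
  ... | yes _ = cornerY
  ... | no  _ = if even y then (x ∸ 2 , suc y , suc y) else (x + 2 , y ∸ 1 , y ∸ 1)

  xPartner : Point → Point
  xPartner (x , y , z) with y ≟ z
  ... | yes _ = xDiagonal x y
  ... | no  _ with (x , y , z) ≟ᴾ cornerY
  ...   | yes _ = midYZ
  ...   | no  _ = (x , z , y)

  xPartner-diagonal : ∀ x y → xPartner (x , y , y) ≡ xDiagonal x y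
  xPartner-diagonal x y with y ≟ y
  ... | yes _  = refl
  ... | no y≢y = contradiction refl y≢y

  xPartner-cornerY : xPartner cornerY ≡ midYZ
  xPartner-cornerY with s ≟ 0
  ... | yes s≡0 = contradiction s≡0 s≢0
  ... | no  _ with cornerY ≟ᴾ cornerY
  ...   | yes _ = refl
  ...   | no  c≢c = contradiction refl c≢c

  xPartner-off-diagonal : ∀ x y z → y ≢ z → (x , y , z) ≢ cornerY → xPartner (x , y , z) ≡ (x , z , y)
  xPartner-off-diagonal x y z y≢z a≢c with y ≟ z
  ... | yes y≡z = contradiction y≡z y≢z
  ... | no  _ with (x , y , z) ≟ᴾ cornerY
  ...   | yes a≡c = contradiction a≡c a≢c
  ...   | no  _   = refl

  xDiagonal-h : ∀ x → xDiagonal x h ≡ cornerY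
  xDiagonal-h x with h ≟ h
  ... | yes _  = refl
  ... | no h≢h = contradiction refl h≢h

  xDiagonal-even : ∀ x y → y ≢ h → even y ≡ true → xDiagonal x y ≡ (x ∸ 2 , suc y , suc y)
  xDiagonal-even x y y≢h y-even with y ≟ h
  ... | yes y≡h = contradiction y≡h y≢h
  ... | no  _ rewrite y-even = refl

  xDiagonal-odd : ∀ x y → y ≢ h → even y ≡ false → xDiagonal x y ≡ (x + 2 , y ∸ 1 , y ∸ 1)
  xDiagonal-odd x y y≢h y-odd with y ≟ h
  ... | yes y≡h = contradiction y≡h y≢h
  ... | no  _ rewrite y-odd = refl

  xPartners-midYZ : Partners XParity xPartner midYZ cornerY
  xPartners-midYZ = record
    { vertex    = +-identityʳ s , λ eq → s≢0 (cong yOf eq)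
    ; distinct  = λ eq → h≢0 (sym (cong zOf eq))
    ; off-lineX = λ ()
    ; off-lineY = h+s≢1+s
    ; off-lineZ = ≤s⇒≢1+s (subst (_≤ s) (sym (+-identityʳ h)) h≤s)
    ; parity    = refl , λ _ → refl
    ; back      = xPartner-cornerY
    }

  xPartners-cornerY : Partners XParity xPartner cornerY midYZ
  xPartners-cornerY = record
    { vertex    = refl , λ eq → h≢0 (cong yOf eq)
    ; distinct  = λ eq → m+1+n≢m h (sym (cong yOf eq))
    ; off-lineX = λ ()
    ; off-lineY = λ eq → h+s≢1+s (trans (+-comm h s) eq)
    ; off-lineZ = ≤s⇒≢1+s h≤s
    ; parity    = refl , λ _ → refl
    ; back      = trans (xPartner-diagonal 0 h) (xDiagonal-h 0)
    }

  xPartners-off-diagonal : ∀ {x y z} → IsVertex (x , y , z) → y ≢ z → (x , y , z) ≢ cornerY →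
    Partners XParity xPartner (x , y , z) (x , z , y)
  xPartners-off-diagonal {x} {y} {z} (on , a≢apex) y≢z a≢c = record
    { vertex    = trans (+-swap x y z) on , λ { refl → a≢c refl }
    ; distinct  = λ eq → y≢z (sym (cong yOf eq))
    ; off-lineX = even⇒≢1+s (even-double x)
    ; off-lineY = ≤s⇒≢1+s (y+z≤s {x , y , z} on)
    ; off-lineZ = ≤s⇒≢1+s (subst (_≤ s) (+-comm y z) (y+z≤s {x , y , z} on))
    ; parity    = even-double x , λ _ → refl
    ; back      = xPartner-off-diagonal x z y (y≢z ∘ sym) λ { refl → a≢apex refl }
    }
    where
      +-swap : ∀ x y z → x + z + y ≡ x + y + z
      +-swap = solve-∀

  diagonal-x≥2 : ∀ {x y} → x + y + y ≡ s → y ≢ h → ∃ λ x′ → x ≡ suc (suc x′)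
  diagonal-x≥2 {zero}        {y} on y≢h = contradiction (double-injective on) y≢h
  diagonal-x≥2 {suc zero}    {y} on _   =
    contradiction (trans (sym even-s) (trans (sym (cong even on)) (even-1+double y))) λ ()
  diagonal-x≥2 {suc (suc x)} _ _        = x , refl

  diagonal-y≢h : ∀ {x y} → x + suc y + suc y ≡ s → y ≢ h
  diagonal-y≢h {x} {y} on refl = m+1+n≢m (h + h) (trans (regroup x h) on)
    where
      regroup : ∀ x h → h + h + suc (suc x) ≡ x + suc h + suc h
      regroup = solve-∀

  xPartners-diagonal-even : ∀ {x y} → suc (suc x) + y + y ≡ s → y ≢ h → even y ≡ true →
    Partners XParity xPartner (suc (suc x) , y , y) (x , suc y , suc y)
  xPartners-diagonal-even {x} {y} on y≢h y-even = record
    { vertex    = trans (shift x y) on , λ ()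
    ; distinct  = λ eq → 1+n≢n (cong yOf eq)
    ; off-lineX = even⇒≢1+s (even-double x)
    ; off-lineY = y≢h ∘ y+1+y≡1+s⇒y≡h
    ; off-lineZ = y≢h ∘ y+1+y≡1+s⇒y≡h
    ; parity    = even-double x , λ y-sum-even → contradiction (trans (sym y-sum-even) (even-y+1+y y)) λ ()
    ; back      = trans (xPartner-diagonal x (suc y))
                    (trans (xDiagonal-odd x (suc y) 1+y≢h 1+y-odd) (point-≡ (+-comm x 2) refl refl))
    }
    where
      shift : ∀ x y → x + suc y + suc y ≡ suc (suc x) + y + y
      shift = solve-∀
      1+y-odd : even (suc y) ≡ false
      1+y-odd = trans (even-suc y) (cong not y-even)
      1+y≢h : suc y ≢ h
      1+y≢h eq = contradiction (trans (sym even-h) (trans (cong even (sym eq)) 1+y-odd)) λ ()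

  xPartners-diagonal-odd : ∀ {x y} → x + suc y + suc y ≡ s → even (suc y) ≡ false →
    Partners XParity xPartner (x , suc y , suc y) (x + 2 , y , y)
  xPartners-diagonal-odd {x} {y} on 1+y-odd = record
    { vertex    = trans (shift x y) on , λ eq → m+1+n≢0 x (cong xOf eq)
    ; distinct  = λ eq → m+1+n≢m x (cong xOf eq)
    ; off-lineX = even⇒≢1+s (even-+-same x (x + 2) (sym (even-+2 x)))
    ; off-lineY = λ eq → y≢h (double-injective (suc-injective eq))
    ; off-lineZ = λ eq → y≢h (double-injective (suc-injective eq))
    ; parity    = even-+-same x (x + 2) (sym (even-+2 x)) ,
                  λ even-1+2y → contradiction (trans (sym even-1+2y) (even-1+double y)) λ ()
    ; back      = trans (xPartner-diagonal (x + 2) y)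
                    (trans (xDiagonal-even (x + 2) y y≢h y-even) (point-≡ (m+n∸n≡m x 2) refl refl))
    }
    where
      shift : ∀ x y → x + 2 + y + y ≡ x + suc y + suc y
      shift = solve-∀
      y≢h : y ≢ h
      y≢h = diagonal-y≢h on
      y-even : even y ≡ true
      y-even = not-injective (trans (sym (even-suc y)) 1+y-odd)

  xPartners : ∀ {a} → IsVertex a → Partners XParity xPartner a (xPartner a)
  xPartners {x , y , z} a-vertex with y ≟ z
  xPartners {x , y , .y} (on , _) | yes refl with y ≟ h
  ... | yes refl = subst (λ x → Partners XParity xPartner (x , h , h) cornerY)
                         (sym (+-cancelʳ-≡ (h + h) x 0 (trans (sym (+-assoc x h h)) on))) xPartners-midYZ
  ... | no  y≢h with even y in y-parity
  ...   | true with diagonal-x≥2 {x} on y≢h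
  ...     | x′ , refl = xPartners-diagonal-even on y≢h y-parity
  xPartners {x , zero , .zero} _ | yes refl | no _ | false = contradiction y-parity λ ()
  xPartners {x , suc y , .(suc y)} (on , _) | yes refl | no _ | false = xPartners-diagonal-odd on y-parity
  xPartners {x , y , z} a-vertex | no y≢z with (x , y , z) ≟ᴾ cornerY
  ... | yes refl = xPartners-cornerY
  ... | no  a≢c  = xPartners-off-diagonal a-vertex y≢z a≢c

  YParity : Point → Point → Set
  YParity a e = XParity (swapXY a) (swapXY e)

  yPartner : Point → Point
  yPartner = swapXY ∘ xPartner ∘ swapXY

  yPartners : ∀ {a} → IsVertex a → Partners YParity yPartner a (yPartner a)
  yPartners {a} (on , a≢apex) = record
    { vertex    = swapXY-onTriangle {xPartner (swapXY a)} (proj₁ vertex) , λ eq → proj₂ vertex (cong swapXY eq)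
    ; distinct  = λ eq → distinct (cong swapXY eq)
    ; off-lineX = off-lineY
    ; off-lineY = off-lineX
    ; off-lineZ = off-lineZ
    ; parity    = parity
    ; back      = cong swapXY back
    }
    where
      open Partners (xPartners {swapXY a} (swapXY-onTriangle {a} on , λ eq → a≢apex (cong swapXY eq)))

  ZParity : Point → Point → Set
  ZParity a e = even (zOf a + zOf e) ≡ true × (even (xOf a + xOf e) ≡ true → zOf a ≡ zOf e) ×
                (zOf a ≡ zOf e → xOf e ≡ yOf a)

  -- On the diagonal x = y the points with x ≥ 1 are paired (2j - 1 , 2j - 1 , z) ↔ (2j , 2j , z - 2);
  -- the diagonal point with x = 0 is the apex itself.
  zPartner : Point → Point
  zPartner (x , y , z) with x ≟ y
  ... | yes _ = if even x then (x ∸ 1 , x ∸ 1 , suc (suc z)) else (suc x , suc x , z ∸ 2)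
  ... | no  _ = (y , x , z)

  zPartner-even : ∀ x z → even x ≡ true → zPartner (x , x , z) ≡ (x ∸ 1 , x ∸ 1 , suc (suc z))
  zPartner-even x z x-even with x ≟ x
  ... | yes _   rewrite x-even = refl
  ... | no  x≢x = contradiction refl x≢x

  zPartner-odd : ∀ x z → even x ≡ false → zPartner (x , x , z) ≡ (suc x , suc x , z ∸ 2)
  zPartner-odd x z x-odd with x ≟ x
  ... | yes _   rewrite x-odd = refl
  ... | no  x≢x = contradiction refl x≢x

  zPartner-off-diagonal : ∀ x y z → x ≢ y → zPartner (x , y , z) ≡ (y , x , z)
  zPartner-off-diagonal x y z x≢y with x ≟ y
  ... | yes x≡y = contradiction x≡y x≢y
  ... | no  _   = refl

  zPartners-off-diagonal : ∀ {x y z} → IsVertex (x , y , z) → x ≢ y → Partners ZParity zPartner (x , y , z) (y , x , z)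
  zPartners-off-diagonal {x} {y} {z} (on , a≢apex) x≢y = record
    { vertex    = swapXY-onTriangle {x , y , z} on , λ { refl → a≢apex refl }
    ; distinct  = λ eq → x≢y (sym (cong xOf eq))
    ; off-lineX = ≤s⇒≢1+s (x+y≤s {x , y , z} on)
    ; off-lineY = ≤s⇒≢1+s (subst (_≤ s) (+-comm x y) (x+y≤s {x , y , z} on))
    ; off-lineZ = even⇒≢1+s (even-double z)
    ; parity    = even-double z , (λ _ → refl) , (λ _ → refl)
    ; back      = zPartner-off-diagonal y x z (x≢y ∘ sym)
    }

  zPartners-diagonal-even : ∀ {x z} → suc x + suc x + z ≡ s → even (suc x) ≡ true →
    Partners ZParity zPartner (suc x , suc x , z) (x , x , suc (suc z))
  zPartners-diagonal-even {x} {z} on 1+x-even = record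
    { vertex    = trans (shift x z) on , λ eq → contradiction (trans (sym (cong even (cong xOf eq))) x-odd) λ ()
    ; distinct  = λ eq → 1+n≢n (sym (cong xOf eq))
    ; off-lineX = λ eq → x≢h (double-injective (suc-injective eq))
    ; off-lineY = λ eq → x≢h (double-injective (suc-injective eq))
    ; off-lineZ = even⇒≢1+s (even-+-same z (suc (suc z)) refl)
    ; parity    = even-+-same z (suc (suc z)) refl ,
                  (λ even-1+2x → contradiction (trans (sym even-1+2x) (even-1+double x)) λ ()) ,
                  (λ z≡2+z → contradiction z≡2+z (m≢1+n+m z))
    ; back      = zPartner-odd x (suc (suc z)) x-odd
    }
    where
      shift : ∀ x z → x + x + suc (suc z) ≡ suc x + suc x + z
      shift = solve-∀
      x-odd : even x ≡ false
      x-odd = not-injective (trans (sym (even-suc x)) 1+x-even)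
      x≢h : x ≢ h
      x≢h refl = m+1+n≢m (h + h) (trans (regroup h z) on)
        where
          regroup : ∀ h z → h + h + suc (suc z) ≡ suc h + suc h + z
          regroup = solve-∀

  zPartners-diagonal-odd : ∀ {x z} → x + x + suc (suc z) ≡ s → even x ≡ false →
    Partners ZParity zPartner (x , x , suc (suc z)) (suc x , suc x , z)
  zPartners-diagonal-odd {x} {z} on x-odd = record
    { vertex    = trans (shift x z) on , λ ()
    ; distinct  = λ eq → 1+n≢n (cong xOf eq)
    ; off-lineX = x+1+x≢1+s
    ; off-lineY = x+1+x≢1+s
    ; off-lineZ = even⇒≢1+s (even-+-same (suc (suc z)) z refl)
    ; parity    = even-+-same (suc (suc z)) z refl ,
                  (λ even-x+1+x → contradiction (trans (sym even-x+1+x) (even-y+1+y x)) λ ()) ,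
                  (λ 2+z≡z → contradiction (sym 2+z≡z) (m≢1+n+m z))
    ; back      = zPartner-even (suc x) z (trans (even-suc x) (cong not x-odd))
    }
    where
      shift : ∀ x z → suc x + suc x + z ≡ x + x + suc (suc z)
      shift = solve-∀
      x+1+x≢1+s : x + suc x ≢ suc s
      x+1+x≢1+s eq = contradiction (trans (sym even-h) (trans (cong even (sym (y+1+y≡1+s⇒y≡h eq))) x-odd)) λ ()

  diagonal-z≥2 : ∀ {x z} → x + x + z ≡ s → even x ≡ false → ∃ λ z′ → z ≡ suc (suc z′)
  diagonal-z≥2 {x} {zero} on x-odd =
    contradiction (trans (sym even-h) (trans (cong even (sym (double-injective {x} {h} (trans (sym (+-identityʳ (x + x))) on)))) x-odd)) λ ()
  diagonal-z≥2 {x} {suc zero} on _ =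
    contradiction (trans (sym even-s) (trans (cong even (sym on)) (trans (cong even (+-comm (x + x) 1)) (even-1+double x)))) λ ()
  diagonal-z≥2 {z = suc (suc z)} _ _ = z , refl

  zPartners : ∀ {a} → IsVertex a → Partners ZParity zPartner a (zPartner a)
  zPartners {x , y , z} a-vertex with x ≟ y
  zPartners {x , .x , z} (on , a≢apex) | yes refl with even x in x-parity
  zPartners {zero , .zero , z} (on , a≢apex) | yes refl | true = contradiction (cong (λ w → (0 , 0 , w)) on) a≢apex
  zPartners {suc x , .(suc x) , z} (on , _) | yes refl | true = zPartners-diagonal-even on x-parity
  zPartners {x , .x , z} (on , _) | yes refl | false with diagonal-z≥2 {x} on x-parity
  ... | z′ , refl = zPartners-diagonal-odd on x-parity
  zPartners {x , y , z} a-vertex | no x≢y = zPartners-off-diagonal a-vertex x≢y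

  RowParity : Point → Point → Set
  RowParity a e = zOf e ≡ zOf a × even (xOf a + xOf e) ≡ true × even (yOf a + yOf e) ≡ true ×
                  xOf a ≢ xOf e × yOf a ≢ yOf e

  -- The row z = 1 has no z-line (it would lead to the apex); instead its s points are paired
  -- x ↔ x + 2 for x ≡ 0, 1 (mod 4), which needs s ≡ 0 (mod 4).
  rowPartner : Point → Point
  rowPartner (x , y , z) = if lowMod4 x then (x + 2 , y ∸ 2 , z) else (x ∸ 2 , y + 2 , z)

  rowPartner-low : ∀ x y z → lowMod4 x ≡ true → rowPartner (x , y , z) ≡ (x + 2 , y ∸ 2 , z)
  rowPartner-low x y z low rewrite low = refl

  rowPartner-high : ∀ x y z → lowMod4 x ≡ false → rowPartner (x , y , z) ≡ (x ∸ 2 , y + 2 , z)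
  rowPartner-high x y z high rewrite high = refl

  s≡4+4*k : s ≡ 4 + 4 * k
  s≡4+4*k = expand k
    where
      expand : ∀ k → (suc k + suc k) + (suc k + suc k) ≡ 4 + 4 * k
      expand = solve-∀

  row-y≥2 : ∀ {x y} → x + y + 1 ≡ s → lowMod4 x ≡ true → ∃ λ y′ → y ≡ suc (suc y′)
  row-y≥2 {x} {zero} on low = contradiction (trans (sym low) (trans (cong lowMod4 x≡) (lowMod4-3+4* k))) λ ()
    where
      x≡ : x ≡ 3 + 4 * k
      x≡ = suc-injective (trans (one x) (trans on s≡4+4*k))
        where
          one : ∀ x → suc x ≡ x + 0 + 1
          one = solve-∀
  row-y≥2 {x} {suc zero} on low = contradiction (trans (sym low) (trans (cong lowMod4 x≡) (lowMod4-2+4* k))) λ ()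
    where
      x≡ : x ≡ 2 + 4 * k
      x≡ = suc-injective (suc-injective (trans (two x) (trans on s≡4+4*k)))
        where
          two : ∀ x → suc (suc x) ≡ x + 1 + 1
          two = solve-∀
  row-y≥2 {y = suc (suc y)} _ _ = y , refl

  rowPartners-low : ∀ {x y} → x + suc (suc y) + 1 ≡ s → lowMod4 x ≡ true →
    Partners RowParity rowPartner (x , suc (suc y) , 1) (x + 2 , y , 1)
  rowPartners-low {x} {y} on low = record
    { vertex    = trans (shift x y) on , λ eq → m+1+n≢0 x (cong xOf eq)
    ; distinct  = λ eq → m+1+n≢m x (cong xOf eq)
    ; off-lineX = even⇒≢1+s x-sum-even
    ; off-lineY = even⇒≢1+s y-sum-even
    ; off-lineZ = even⇒≢1+s refl
    ; parity    = refl , x-sum-even , y-sum-even , (λ eq → m+1+n≢m x (sym eq)) , (λ eq → m≢1+n+m y (sym eq))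
    ; back      = trans (rowPartner-high (x + 2) y 1 (trans (lowMod4-+2 x) (cong not low)))
                        (point-≡ (m+n∸n≡m x 2) (+-comm y 2) refl)
    }
    where
      shift : ∀ x y → x + 2 + y + 1 ≡ x + suc (suc y) + 1
      shift = solve-∀
      x-sum-even : even (x + (x + 2)) ≡ true
      x-sum-even = even-+-same x (x + 2) (sym (even-+2 x))
      y-sum-even : even (suc (suc y) + y) ≡ true
      y-sum-even = even-+-same (suc (suc y)) y refl

  rowPartners-high : ∀ {x y} → suc (suc x) + y + 1 ≡ s → lowMod4 (suc (suc x)) ≡ false →
    Partners RowParity rowPartner (suc (suc x) , y , 1) (x , y + 2 , 1)
  rowPartners-high {x} {y} on high = record
    { vertex    = trans (shift x y) on , λ eq → m+1+n≢0 y (cong yOf eq)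
    ; distinct  = λ eq → m≢1+n+m x (cong xOf eq)
    ; off-lineX = even⇒≢1+s x-sum-even
    ; off-lineY = even⇒≢1+s y-sum-even
    ; off-lineZ = even⇒≢1+s refl
    ; parity    = refl , x-sum-even , y-sum-even , (λ eq → m≢1+n+m x (sym eq)) , (λ eq → m+1+n≢m y (sym eq))
    ; back      = trans (rowPartner-low x (y + 2) 1 x-low) (point-≡ (+-comm x 2) (m+n∸n≡m y 2) refl)
    }
    where
      shift : ∀ x y → x + (y + 2) + 1 ≡ suc (suc x) + y + 1
      shift = solve-∀
      x-sum-even : even (suc (suc x) + x) ≡ true
      x-sum-even = even-+-same (suc (suc x)) x refl
      y-sum-even : even (y + (y + 2)) ≡ true
      y-sum-even = even-+-same y (y + 2) (sym (even-+2 y))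
      x-low : lowMod4 x ≡ true
      x-low = not-injective (trans (sym (lowMod4-2+ x)) high)

  rowPartners : ∀ {x y} → x + y + 1 ≡ s → Partners RowParity rowPartner (x , y , 1) (rowPartner (x , y , 1))
  rowPartners {x} {y} on with lowMod4 x in x-parity
  ... | true with row-y≥2 {x} {y} on x-parity
  ...   | y′ , refl = rowPartners-low on x-parity
  rowPartners {zero}        on | false = contradiction x-parity λ ()
  rowPartners {suc zero}    on | false = contradiction x-parity λ ()
  rowPartners {suc (suc x)} on | false = rowPartners-high on x-parity

  even-third : ∀ p q r → even p ≡ true → even q ≡ true → p + q + r ≡ s + s → even r ≡ true
  even-third p q r p-even q-even p+q+r≡ =
    trans (sym (even-+-evenˡ (p + q) r (even-+-same p q (trans p-even (sym q-even)))))
          (trans (cong even p+q+r≡) (even-double s))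

  sum-of-sums : ∀ {a e} → OnTriangle a → OnTriangle e →
    (yOf a + yOf e) + (zOf a + zOf e) + (xOf a + xOf e) ≡ s + s
  sum-of-sums {x , y , z} {x′ , y′ , z′} on on′ = trans (regroup x y z x′ y′ z′) (cong₂ _+_ on on′)
    where
      regroup : ∀ x y z x′ y′ z′ → (y + y′) + (z + z′) + (x + x′) ≡ (x + y + z) + (x′ + y′ + z′)
      regroup = solve-∀

  even-x-sum : ∀ {a e} → OnTriangle a → OnTriangle e →
    even (yOf a + yOf e) ≡ true → even (zOf a + zOf e) ≡ true → even (xOf a + xOf e) ≡ true
  even-x-sum {a} {e} on on′ y-even z-even =
    even-third (yOf a + yOf e) (zOf a + zOf e) (xOf a + xOf e) y-even z-even (sum-of-sums {a} {e} on on′)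

  even-y-sum : ∀ {a e} → OnTriangle a → OnTriangle e →
    even (xOf a + xOf e) ≡ true → even (zOf a + zOf e) ≡ true → even (yOf a + yOf e) ≡ true
  even-y-sum {a} {e} on on′ = even-x-sum {swapXY a} {swapXY e} (swapXY-onTriangle {a} on) (swapXY-onTriangle {e} on′)

  XParity∧YParity⇒≡ : ∀ {a e} → OnTriangle a → OnTriangle e → XParity a e → YParity a e → e ≡ a
  XParity∧YParity⇒≡ {a} {e} on on′ (x-even , x-same) (y-even , y-same) =
    sym (onTriangle-xy {a} {e} on on′ (x-same y-even) (y-same x-even))

  XParity∧ZParity⇒≡ : ∀ {a e} → OnTriangle a → OnTriangle e → XParity a e → ZParity a e → e ≡ a
  XParity∧ZParity⇒≡ {a} {e} on on′ (x-even , x-same) (z-even , z-same , _) =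
    sym (onTriangle-xz {a} {e} on on′ (x-same (even-y-sum {a} {e} on on′ x-even z-even)) (z-same x-even))

  YParity∧ZParity⇒≡ : ∀ {a e} → OnTriangle a → OnTriangle e → YParity a e → ZParity a e → e ≡ a
  YParity∧ZParity⇒≡ {a} {e} on on′ (y-even , y-same) (z-even , z-same , _) =
    sym (onTriangle-yz {a} {e} on on′ (y-same x-even) (z-same x-even))
    where
      x-even = even-x-sum {a} {e} on on′ y-even z-even

  XParity∧RowParity⇒⊥ : ∀ {a e} → XParity a e → RowParity a e → ⊥
  XParity∧RowParity⇒⊥ (_ , x-same) (_ , _ , y-even , x≢ , _) = x≢ (x-same y-even)

  YParity∧RowParity⇒⊥ : ∀ {a e} → YParity a e → RowParity a e → ⊥
  YParity∧RowParity⇒⊥ (_ , y-same) (_ , x-even , _ , _ , y≢) = y≢ (y-same x-even)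

  ZParity∧RowParity⇒⊥ : ∀ {a e} → OnTriangle a → zOf a ≡ 1 → ZParity a e → RowParity a e → ⊥
  ZParity∧RowParity⇒⊥ {x , y , .1} on refl (_ , _ , swapped) (z≡ , x-even , _) =
    contradiction (trans (sym x-even) (trans (cong (λ w → even (x + w)) (swapped (sym z≡))) x+y-odd)) λ ()
    where
      x+y-odd : even (x + y) ≡ false
      x+y-odd = not-injective (trans (sym (even-suc (x + y)))
                  (trans (cong even (+-comm 1 (x + y))) (trans (cong even on) even-s)))

  record ColourClass (coord : Point → ℕ) : Set where
    field
      partner            : Point → Point
      rest               : Point → List Point
      partner-vertex     : ∀ {a} → IsVertex a → IsVertex (partner a)
      partner-distinct   : ∀ {a} → IsVertex a → partner a ≢ a
      partner-involutive : ∀ {a} → IsVertex a → partner (partner a) ≡ a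
      partner∉rest       : ∀ {a} → IsVertex a → partner a ∉ rest a
      rest-vertex        : ∀ {a b} → IsVertex a → b ∈ rest a → IsVertex b
      rest-sym           : ∀ {a b} → IsVertex a → b ∈ rest a → a ∈ rest b
      rest-irrefl        : ∀ {a} → IsVertex a → a ∉ rest a
      rest-unique        : ∀ a → Unique (rest a)
      length-rest        : ∀ a → length (rest a) ≡ coord a

    nbrs : Point → List Point
    nbrs a = partner a ∷ rest a

    nbrs-vertex : ∀ {a b} → IsVertex a → b ∈ nbrs a → IsVertex b
    nbrs-vertex a-vertex (here refl) = partner-vertex a-vertex
    nbrs-vertex a-vertex (there b∈)  = rest-vertex a-vertex b∈

    nbrs-sym : ∀ {a b} → IsVertex a → b ∈ nbrs a → a ∈ nbrs b
    nbrs-sym a-vertex (here refl) = here (sym (partner-involutive a-vertex))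
    nbrs-sym a-vertex (there b∈)  = there (rest-sym a-vertex b∈)

    nbrs-irrefl : ∀ {a} → IsVertex a → a ∉ nbrs a
    nbrs-irrefl a-vertex (here a≡) = partner-distinct a-vertex (sym a≡)
    nbrs-irrefl a-vertex (there a∈) = rest-irrefl a-vertex a∈

    nbrs-unique : ∀ {a} → IsVertex a → Unique (nbrs a)
    nbrs-unique {a} a-vertex =
      All.tabulate (λ b∈ partner≡b → partner∉rest a-vertex (subst (_∈ rest a) (sym partner≡b) b∈)) ∷ rest-unique a

    length-nbrs : ∀ a → length (nbrs a) ≡ suc (coord a)
    length-nbrs a = cong suc (length-rest a)

  on-line-sym : ∀ {c a b} → OnTriangle a → OnLine c a b → OnLine c b a
  on-line-sym {c} {a} {b} on (_ , on-line) = on , trans (+-comm (c b) (c a)) on-line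

  ¬on-line-self : ∀ {c a} → ¬ OnLine c a a
  ¬on-line-self {c} {a} (_ , on-line) = even⇒≢1+s (even-double (c a)) on-line

  lineClass : ∀ {Parity} (F : Frame) → xOf (Frame.to F apex) ≡ 0 → (m : Point → Point) →
    (∀ {a} → IsVertex a → Partners Parity m a (m a)) →
    (∀ {a} → IsVertex a → xOf (Frame.to F a) + xOf (Frame.to F (m a)) ≢ suc s) →
    ColourClass (xOf ∘ Frame.to F)
  lineClass F apex-on-axis m partners off-line = record
    { partner            = m
    ; rest               = line F
    ; partner-vertex     = Partners.vertex ∘ partners
    ; partner-distinct   = Partners.distinct ∘ partners
    ; partner-involutive = Partners.back ∘ partners
    ; partner∉rest       = λ a-vertex m∈ → off-line a-vertex (proj₂ (line-sound F (proj₁ a-vertex) m∈))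
    ; rest-vertex        = rest-vertex
    ; rest-sym           = rest-sym
    ; rest-irrefl        = λ {a} (on , _) a∈ → ¬on-line-self {xOf ∘ to} {a} (line-sound F on a∈)
    ; rest-unique        = line-unique F
    ; length-rest        = length-line F
    }
    where
      open Frame F
      rest-sym : ∀ {a b} → IsVertex a → b ∈ line F a → a ∈ line F b
      rest-sym {a} {b} (on , _) b∈ =
        line-complete F (proj₁ (line-sound F on b∈)) (on-line-sym {xOf ∘ to} {a} {b} on (line-sound F on b∈))
      rest-vertex : ∀ {a b} → IsVertex a → b ∈ line F a → IsVertex b
      rest-vertex {a} (on , _) b∈ with line-sound F on b∈
      ... | on-b , on-line = on-b , λ { refl → ≤s⇒≢1+s (x≤s {to a} (to-onTriangle on))
                                                  (trans (sym (+-identityʳ _)) (trans (cong (xOf (to a) +_) (sym apex-on-axis)) on-line)) }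

  zRest : Point → List Point
  zRest (x , y , zero)        = line frameZ (x , y , zero)
  zRest (x , y , suc zero)    = rowPartner (x , y , 1) ∷ []
  zRest (x , y , suc (suc z)) = line frameZ (x , y , suc (suc z))

  zRest-row : ∀ {a} → zOf a ≡ 1 → zRest a ≡ rowPartner a ∷ []
  zRest-row {x , y , .1} refl = refl

  zRest-line : ∀ {a} → zOf a ≢ 1 → zRest a ≡ line frameZ a
  zRest-line {x , y , zero}        _   = refl
  zRest-line {x , y , suc zero}    z≢1 = contradiction refl z≢1
  zRest-line {x , y , suc (suc z)} _   = refl

  ∈-zRest⁻ : ∀ {a b} → b ∈ zRest a → (zOf a ≡ 1 × b ≡ rowPartner a) ⊎ (zOf a ≢ 1 × b ∈ line frameZ a)
  ∈-zRest⁻ {x , y , zero}        b∈          = inj₂ ((λ ()) , b∈)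
  ∈-zRest⁻ {x , y , suc zero}    (here refl) = inj₁ (refl , refl)
  ∈-zRest⁻ {x , y , suc (suc z)} b∈          = inj₂ ((λ ()) , b∈)

  rowPartners′ : ∀ {a} → OnTriangle a → zOf a ≡ 1 → Partners RowParity rowPartner a (rowPartner a)
  rowPartners′ {x , y , .1} on refl = rowPartners on

  z≡s⇒apex : ∀ {a} → OnTriangle a → zOf a ≡ s → a ≡ apex
  z≡s⇒apex {x , y , .s} on refl = point-≡ (m+n≡0⇒m≡0 x x+y≡0) (m+n≡0⇒n≡0 x x+y≡0) refl
    where
      x+y≡0 : x + y ≡ 0
      x+y≡0 = +-cancelʳ-≡ s (x + y) 0 on

  z-line-off-row : ∀ {a b} → IsVertex a → OnLine zOf a b → zOf b ≢ 1
  z-line-off-row {a} (on , a≢apex) (_ , on-line) zb≡1 =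
    a≢apex (z≡s⇒apex {a} on (+-cancelʳ-≡ 1 (zOf a) s (trans (cong (zOf a +_) (sym zb≡1)) (trans on-line (sym (+-comm s 1))))))

  zClass : ColourClass zOf
  zClass = record
    { partner            = zPartner
    ; rest               = zRest
    ; partner-vertex     = Partners.vertex ∘ zPartners
    ; partner-distinct   = Partners.distinct ∘ zPartners
    ; partner-involutive = Partners.back ∘ zPartners
    ; partner∉rest       = partner∉rest
    ; rest-vertex        = rest-vertex
    ; rest-sym           = rest-sym
    ; rest-irrefl        = rest-irrefl
    ; rest-unique        = rest-unique
    ; length-rest        = length-rest
    }
    where
      partner∉rest : ∀ {a} → IsVertex a → zPartner a ∉ zRest a
      partner∉rest {a} a-vertex m∈ with ∈-zRest⁻ {a} m∈
      ... | inj₁ (z≡1 , m≡row) =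
        ZParity∧RowParity⇒⊥ {a} (proj₁ a-vertex) z≡1 (Partners.parity (zPartners a-vertex))
          (subst (RowParity a) (sym m≡row) (Partners.parity (rowPartners′ {a} (proj₁ a-vertex) z≡1)))
      ... | inj₂ (_ , m∈line) = Partners.off-lineZ (zPartners a-vertex) (proj₂ (line-sound frameZ {a} (proj₁ a-vertex) m∈line))

      rest-vertex : ∀ {a b} → IsVertex a → b ∈ zRest a → IsVertex b
      rest-vertex {a} a-vertex b∈ with ∈-zRest⁻ {a} b∈
      ... | inj₁ (z≡1 , refl) = Partners.vertex (rowPartners′ {a} (proj₁ a-vertex) z≡1)
      ... | inj₂ (z≢1 , b∈line) = on-b , λ { refl → z≢1 (+-cancelʳ-≡ s (zOf a) 1 on-line) }
        where
          on-b = proj₁ (line-sound frameZ {a} (proj₁ a-vertex) b∈line)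
          on-line = proj₂ (line-sound frameZ {a} (proj₁ a-vertex) b∈line)

      rest-sym : ∀ {a b} → IsVertex a → b ∈ zRest a → a ∈ zRest b
      rest-sym {a} {b} a-vertex b∈ with ∈-zRest⁻ {a} b∈
      ... | inj₁ (z≡1 , refl) = subst (a ∈_) (sym (zRest-row {rowPartner a} (trans z≡ z≡1))) (here (sym back))
        where
          open Partners (rowPartners′ {a} (proj₁ a-vertex) z≡1)
          z≡ : zOf (rowPartner a) ≡ zOf a
          z≡ = proj₁ parity
      ... | inj₂ (_ , b∈line) = subst (a ∈_) (sym (zRest-line {b} (z-line-off-row {a} {b} a-vertex b-on-line)))
                                  (line-complete frameZ {b} {a} (proj₁ b-on-line) (on-line-sym {zOf} {a} {b} (proj₁ a-vertex) b-on-line))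
        where
          b-on-line : OnLine zOf a b
          b-on-line = line-sound frameZ {a} {b} (proj₁ a-vertex) b∈line

      rest-irrefl : ∀ {a} → IsVertex a → a ∉ zRest a
      rest-irrefl {a} a-vertex a∈ with ∈-zRest⁻ {a} a∈
      ... | inj₁ (z≡1 , a≡row) = Partners.distinct (rowPartners′ {a} (proj₁ a-vertex) z≡1) (sym a≡row)
      ... | inj₂ (_ , a∈line) = ¬on-line-self {zOf} {a} (line-sound frameZ {a} (proj₁ a-vertex) a∈line)

      rest-unique : ∀ a → Unique (zRest a)
      rest-unique (x , y , zero)        = line-unique frameZ (x , y , zero)
      rest-unique (x , y , suc zero)    = [] ∷ []
      rest-unique (x , y , suc (suc z)) = line-unique frameZ (x , y , suc (suc z))

      length-rest : ∀ a → length (zRest a) ≡ zOf a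
      length-rest (x , y , zero)        = length-line frameZ (x , y , zero)
      length-rest (x , y , suc zero)    = refl
      length-rest (x , y , suc (suc z)) = length-line frameZ (x , y , suc (suc z))

  xClass : ColourClass xOf
  xClass = lineClass frameX refl xPartner xPartners (Partners.off-lineX ∘ xPartners)

  yClass : ColourClass yOf
  yClass = lineClass frameY refl yPartner yPartners (Partners.off-lineY ∘ yPartners)

  coordinate : Fin 3 → Point → ℕ
  coordinate fzero               = xOf
  coordinate (fsuc fzero)        = yOf
  coordinate (fsuc (fsuc fzero)) = zOf

  colourClass : ∀ i → ColourClass (coordinate i)
  colourClass fzero               = xClass
  colourClass (fsuc fzero)        = yClass
  colourClass (fsuc (fsuc fzero)) = zClass

  nbrs : Fin 3 → Point → List Point
  nbrs i = ColourClass.nbrs (colourClass i)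

  xy-disjoint : ∀ {a b} → IsVertex a → b ∈ nbrs fzero a → b ∈ nbrs (fsuc fzero) a → ⊥
  xy-disjoint {a} a-vertex@(on , _) (here refl) (here eq) =
    X.distinct (XParity∧YParity⇒≡ {a} on (proj₁ X.vertex) X.parity (subst (YParity a) (sym eq) Y.parity))
    where
      module X = Partners (xPartners a-vertex)
      module Y = Partners (yPartners a-vertex)
  xy-disjoint {a} a-vertex@(on , _) (here refl) (there b∈) =
    Partners.off-lineY (xPartners a-vertex) (proj₂ (line-sound frameY {a} on b∈))
  xy-disjoint {a} a-vertex@(on , _) (there b∈) (here refl) =
    Partners.off-lineX (yPartners a-vertex) (proj₂ (line-sound frameX {a} on b∈))
  xy-disjoint {a} {b} (on , _) (there b∈x) (there b∈y) =
    lines-cross xOf yOf {a} {b} (x+y≤s {a} on) (x+y≤s {b} (proj₁ on-x)) on-x (line-sound frameY {a} on b∈y)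
    where
      on-x : OnLine xOf a b
      on-x = line-sound frameX {a} {b} on b∈x

  line-z-disjoint : ∀ {Parity} (F : Frame) (m : Point → Point) →
    (∀ {a} → IsVertex a → Partners Parity m a (m a)) →
    (∀ {a e} → OnTriangle a → OnTriangle e → Parity a e → ZParity a e → e ≡ a) →
    (∀ {a e} → Parity a e → RowParity a e → ⊥) →
    (∀ {P m′ a e} → Partners P m′ a e → xOf (Frame.to F a) + xOf (Frame.to F e) ≢ suc s) →
    (∀ {a} → OnTriangle a → xOf (Frame.to F a) + zOf a ≤ s) →
    ∀ {a b} → IsVertex a → b ∈ m a ∷ line F a → b ∈ zPartner a ∷ zRest a → ⊥
  line-z-disjoint F m partners parity-vs-z parity-vs-row off-line bound {a} {b} a-vertex@(on , _) = disjoint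
    where
      module M = Partners (partners a-vertex)
      module Z = Partners (zPartners a-vertex)

      disjoint : b ∈ m a ∷ line F a → b ∈ zPartner a ∷ zRest a → ⊥
      disjoint (here refl) (here eq) =
        M.distinct (parity-vs-z {a} on (proj₁ M.vertex) M.parity (subst (ZParity a) (sym eq) Z.parity))
      disjoint (here refl) (there b∈z) with ∈-zRest⁻ {a} b∈z
      ... | inj₁ (z≡1 , eq) = parity-vs-row M.parity
                                (subst (RowParity a) (sym eq) (Partners.parity (rowPartners′ {a} on z≡1)))
      ... | inj₂ (_ , b∈line) = M.off-lineZ (proj₂ (line-sound frameZ {a} on b∈line))
      disjoint (there b∈c) (here refl) = off-line (zPartners a-vertex) (proj₂ (line-sound F {a} on b∈c))
      disjoint (there b∈c) (there b∈z) with ∈-zRest⁻ {a} b∈z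
      ... | inj₁ (z≡1 , refl) = off-line (rowPartners′ {a} on z≡1) (proj₂ (line-sound F {a} on b∈c))
      ... | inj₂ (_ , b∈line) =
        lines-cross (xOf ∘ Frame.to F) zOf {a} {b} (bound {a} on) (bound {b} (proj₁ on-c)) on-c
                    (line-sound frameZ {a} on b∈line)
        where
          on-c : OnLine (xOf ∘ Frame.to F) a b
          on-c = line-sound F {a} {b} on b∈c

  xz-disjoint : ∀ {a b} → IsVertex a → b ∈ nbrs fzero a → b ∈ nbrs (fsuc (fsuc fzero)) a → ⊥
  xz-disjoint = line-z-disjoint frameX xPartner xPartners (λ {a} {e} → XParity∧ZParity⇒≡ {a} {e})
                  XParity∧RowParity⇒⊥ Partners.off-lineX (λ {a} → x+z≤s {a})

  yz-disjoint : ∀ {a b} → IsVertex a → b ∈ nbrs (fsuc fzero) a → b ∈ nbrs (fsuc (fsuc fzero)) a → ⊥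
  yz-disjoint = line-z-disjoint frameY yPartner yPartners (λ {a} {e} → YParity∧ZParity⇒≡ {a} {e})
                  YParity∧RowParity⇒⊥ Partners.off-lineY (λ {a} → y+z≤s {a})

  nbrs-disjoint : ∀ {i j a b} → IsVertex a → b ∈ nbrs i a → b ∈ nbrs j a → i ≡ j
  nbrs-disjoint {fzero}               {fzero}               _ _ _ = refl
  nbrs-disjoint {fzero}               {fsuc fzero}          v p q = ⊥-elim (xy-disjoint v p q)
  nbrs-disjoint {fzero}               {fsuc (fsuc fzero)}   v p q = ⊥-elim (xz-disjoint v p q)
  nbrs-disjoint {fsuc fzero}          {fzero}               v p q = ⊥-elim (xy-disjoint v q p)
  nbrs-disjoint {fsuc fzero}          {fsuc fzero}          _ _ _ = refl
  nbrs-disjoint {fsuc fzero}          {fsuc (fsuc fzero)}   v p q = ⊥-elim (yz-disjoint v p q)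
  nbrs-disjoint {fsuc (fsuc fzero)}   {fzero}               v p q = ⊥-elim (xz-disjoint v q p)
  nbrs-disjoint {fsuc (fsuc fzero)}   {fsuc fzero}          v p q = ⊥-elim (yz-disjoint v q p)
  nbrs-disjoint {fsuc (fsuc fzero)}   {fsuc (fsuc fzero)}   _ _ _ = refl

  vertices : List Point
  vertices = apexFreeTriples (k + suc k + h)

  ∈-vertices⁻ : ∀ {a} → a ∈ vertices → IsVertex a
  ∈-vertices⁻ = ∈-apexFreeTriples⁻ _

  ∈-vertices⁺ : ∀ {a} → IsVertex a → a ∈ vertices
  ∈-vertices⁺ {a} (on , a≢apex) = ∈-apexFreeTriples⁺ a on a≢apex

  neighbourhoods : ColouredNeighbourhoods vertices 3
  neighbourhoods = record
    { nbrs          = nbrs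
    ; nbrs⊆V        = λ i a∈ b∈ → ∈-vertices⁺ (ColourClass.nbrs-vertex (colourClass i) (∈-vertices⁻ a∈) b∈)
    ; nbrs-unique   = λ i a∈ → ColourClass.nbrs-unique (colourClass i) (∈-vertices⁻ a∈)
    ; nbrs-sym      = λ i a∈ → ColourClass.nbrs-sym (colourClass i) (∈-vertices⁻ a∈)
    ; nbrs-irrefl   = λ i a∈ → ColourClass.nbrs-irrefl (colourClass i) (∈-vertices⁻ a∈)
    ; nbrs-disjoint = λ a∈ → nbrs-disjoint (∈-vertices⁻ a∈)
    }

  open NeighbourhoodGraph _≟ᴾ_ (apexFreeTriples-unique (k + suc k + h)) neighbourhoods

  length-nbrs : ∀ i a → length (nbrs i a) ≡ suc (coordinate i a)
  length-nbrs i = ColourClass.length-nbrs (colourClass i)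

  graph-regular : Regular (3 + s) graph
  graph-regular u =
    begin
      degree graph u
    ≡⟨ degree-graph u ⟩
      sum (tabulate λ i → length (nbrs i a))
    ≡⟨ cong sum (tabulate-cong λ i → length-nbrs i a) ⟩
      suc (xOf a) + (suc (yOf a) + (suc (zOf a) + 0))
    ≡⟨ regroup (xOf a) (yOf a) (zOf a) ⟩
      3 + total a
    ≡⟨ cong (3 +_) (proj₁ (∈-vertices⁻ (∈-lookup u))) ⟩
      3 + s
    ∎
    where
      open ≡-Reasoning
      a : Point
      a = vertex u
      regroup : ∀ x y z → suc x + (suc y + (suc z + 0)) ≡ 3 + (x + y + z)
      regroup = solve-∀

  colouring-kaleidoscopic : IsKaleidoscopic colouring
  colouring-kaleidoscopic = colouring-isKaleidoscopic
    (λ i {a} _ → subst (1 ≤_) (sym (length-nbrs i a)) (s≤s z≤n))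
    (λ {a} {b} _ _ same → point-≡ (same-coordinate fzero same) (same-coordinate (fsuc fzero) same)
                                  (same-coordinate (fsuc (fsuc fzero)) same))
    where
      same-coordinate : ∀ {a b} i → (∀ j → length (nbrs j a) ≡ length (nbrs j b)) →
        coordinate i a ≡ coordinate i b
      same-coordinate {a} {b} i same = suc-injective (trans (sym (length-nbrs i a)) (trans (same i) (length-nbrs i b)))

  kaleidoscope : Σ (Graph (suc (suc s) C 2 ∸ 1)) (λ G → Regular (3 + s) G × IsKaleidoscope 3 G)
  kaleidoscope = subst (λ n → Σ (Graph n) (λ G → Regular (3 + s) G × IsKaleidoscope 3 G))
                       (length-apexFreeTriples (k + suc k + h))
                       (graph , graph-regular , colouring , colouring-kaleidoscopic)

r≡3+4[k+1] : ∀ r → r ≥ 7 → r % 4 ≡ 3 → ∃ λ k → r ≡ 3 + Construction.s k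
r≡3+4[k+1] r r≥7 r%4≡3 with r / 4 | m≡m%n+[m/n]*n r 4
... | zero  | r≡ = contradiction (subst (7 ≤_) (trans r≡ (cong (_+ 0) r%4≡3)) r≥7) λ { (s≤s (s≤s (s≤s ()))) }
... | suc k | r≡ = k , trans r≡ (trans (cong (_+ suc k * 4) r%4≡3) (expand k))
  where
    expand : ∀ k → 3 + suc k * 4 ≡ 3 + ((suc k + suc k) + (suc k + suc k))
    expand = solve-∀

mainTheorem2 : (r : ℕ) → r ≥ 7 → r % 4 ≡ 3 →
    Σ (Graph (((r ∸ 1) C 2) ∸ 1)) (λ G → Regular r G × IsKaleidoscope 3 G)
mainTheorem2 r r≥7 r%4≡3 with r≡3+4[k+1] r r≥7 r%4≡3
... | k , refl = Construction.kaleidoscope k
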